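{- Let $n\ge 2$ be an integer. For every integer $m\in\{1,\dots,n-1\}$ there is a graph $G$ such that $\nu(H)=n$ and $\gamma(H)=m$ for every $H\in\Gamma_0(G)$.
   Context: A hypergraph $H$ has a finite non-empty vertex set and a collection of non-empty subsets (hyperedges); rank is the maximum hyperedge size. Two vertices are adjacent if some hyperedge contains both. $\nu(H)$ is the maximum number of pairwise disjoint hyperedges; $\gamma(H)$ is the minimum size of a set $D$ of vertices such that every vertex not in $D$ is adjacent to a vertex of $D$. Dilation of a simple graph $G$: for $k\ge 3$, assign to each vertex $v$ a positive integer $s_v$ with $s_u+s_v\le k$ for every edge $uv$; for each vertex $v$ let $\mathbf v$ be an $s_v$-set containing $v$, and for each edge $e=uv$ let $\mathbf e$ be a set of size at most $k-s_u-s_v$, all these sets pairwise disjoint. A dilation of $G$ is a hypergraph of rank $k$ with vertex set $\bigcup_v\mathbf v\cup\bigcup_e\mathbf e$ and hyperedges $\mathbf u\cup\mathbf v\cup\mathbf e$ for $e=uv\in E(G)$. $\Gamma_0(G)$ is the set of dilations of $G$ with $\mathbf e=\emptyset$ for every edge $e$. -}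

module Defs where

open import Data.Nat using (ℕ; _+_; _≤_)
open import Data.Fin using (Fin; _≟_)
open import Data.Fin.Subset using (Subset; _∈_; _∉_; ∣_∣)
open import Data.Vec using (tabulate)
open import Data.Product using (Σ; ∃; _×_; _,_; proj₁; proj₂)
open import Data.Sum using (_⊎_)
open import Relation.Nullary using (¬_)
open import Relation.Nullary.Decidable using (⌊_⌋)
open import Relation.Binary.PropositionalEquality using (_≡_; _≢_)

SameEnds : {N : ℕ} → Fin N × Fin N → Fin N × Fin N → Set
SameEnds (a , b) (c , d) = (a ≡ c × b ≡ d) ⊎ (a ≡ d × b ≡ c)

record Graph : Set where
  field
    N        : ℕ
    someVtx  : Fin N
    M        : ℕ
    ends     : Fin M → Fin N × Fin N
    loopless : ∀ e → proj₁ (ends e) ≢ proj₂ (ends e)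
    simple   : ∀ e f → SameEnds (ends e) (ends f) → e ≡ f

record Hypergraph : Set₁ where
  field
    V        : ℕ
    someVtx  : Fin V
    E        : ℕ
    edge     : Fin E → Fin V → Set
    edgeNonempty : ∀ e → ∃ λ x → edge e x

module _ (H : Hypergraph) where
  open Hypergraph H

  Adjacent : Fin V → Fin V → Set
  Adjacent x y = ∃ λ e → edge e x × edge e y

  Dominating : Subset V → Set
  Dominating D = ∀ x → x ∉ D → ∃ λ y → y ∈ D × Adjacent x y

  DominationNumberIs : ℕ → Set
  DominationNumberIs m =
    (∃ λ D → Dominating D × ∣ D ∣ ≡ m) × (∀ D → Dominating D → m ≤ ∣ D ∣)

  Matching : ℕ → Set
  Matching k = Σ (Fin k → Fin E) λ f →
    ∀ i j → i ≢ j → ∀ x → ¬ (edge (f i) x × edge (f j) x)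

  MatchingNumberIs : ℕ → Set
  MatchingNumberIs n = Matching n × (∀ k → Matching k → k ≤ n)

-- Dilations in Γ₀(G) (all edge-sets 𝐞 empty).  The vertex set of the
-- dilation is Fin nV, partitioned into the blocks 𝐯 = blk⁻¹(v); s_v = |𝐯|.
-- The hyperedge of the edge e = uv is 𝐮 ∪ 𝐯.

record Γ₀ (G : Graph) : Set where
  open Graph G
  field
    nV  : ℕ
    blk : Fin nV → Fin N
    k   : ℕ
    3≤k : 3 ≤ k
    blockNonempty : ∀ v → ∃ λ x → blk x ≡ v
  size : Fin N → ℕ
  size v = ∣ tabulate (λ x → ⌊ blk x ≟ v ⌋) ∣
  field
    sizeBound : ∀ e → size (proj₁ (ends e)) + size (proj₂ (ends e)) ≤ k

dilation : {G : Graph} → Γ₀ G → Hypergraph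
dilation {G} D = record
  { V = nV
  ; someVtx = proj₁ (blockNonempty (Graph.someVtx G))
  ; E = Graph.M G
  ; edge = λ e x → (blk x ≡ proj₁ (Graph.ends G e)) ⊎ (blk x ≡ proj₂ (Graph.ends G e))
  ; edgeNonempty = λ e → let (x , p) = blockNonempty (proj₁ (Graph.ends G e)) in x , Data.Sum.inj₁ p
  }
  where open Γ₀ D

-- The hypergraphs of Γ₀(G) have the same matchings and the same "domination structure"
-- as G itself: a hyperedge contains a vertex exactly when the underlying edge contains
-- its block, and every block is non-empty.  Take G to be a disjoint union of m windmills
-- (friendship graphs) with n triangles in total.  Two edges of a triangle always meet,
-- and the n rims are pairwise disjoint, so ν = n; the hubs dominate, and a dominating set
-- needs a vertex in each of the m components, so γ = m.
module Submission where

open import Defs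
open import Data.Nat using (ℕ; _≤_; _<_)
open import Data.Product using (Σ; _×_)

open import Data.Nat using (zero; suc; z≤n; s≤s; _+_; _∸_)
open import Data.Nat.Properties using (≤-trans; ≤-antisym; <⇒≤; m+[n∸m]≡n)
open import Data.Fin as Fin using (Fin; splitAt; _↑ˡ_)
open import Data.Fin.Properties using (+↔⊎; splitAt-↑ˡ; injective⇒≤; suc-injective; 0≢1+n)
open import Data.Fin.Subset using (Subset; _∈_; ∣_∣; ⊥; ⁅_⁆; _∪_; _-_; inside; outside)
open import Data.Fin.Subset.Properties
  using (_∈?_; ∪-identityˡ; ∣p∣≤∣x∷p∣; ∣⊥∣≡0; x∈⁅x⁆; x∈p∪q⁺; x∈p∧x≢y⇒x∈p-y; x∈p⇒∣p-x∣<∣p∣)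
open import Data.Product using (∃; _,_; proj₁; proj₂; map)
open import Data.Sum as Sum using (_⊎_; inj₁; inj₂; [_,_]′)
open import Data.Sum.Function.Propositional using (_⊎-↔_)
open import Data.Vec using (_∷_)
open import Function using (_∘_; id; const; _↔_; Inverse)
open import Function.Definitions using (Injective)
open import Function.Properties.Inverse using (↔-refl; ↔-trans)
open import Relation.Nullary using (¬_; yes; no; contradiction)
open import Relation.Binary.PropositionalEquality

∣⁅x⁆∪p∣≤1+∣p∣ : ∀ {n} (x : Fin n) (p : Subset n) → ∣ ⁅ x ⁆ ∪ p ∣ ≤ suc ∣ p ∣
∣⁅x⁆∪p∣≤1+∣p∣ Fin.zero    (b ∷ p) rewrite ∪-identityˡ p = s≤s (∣p∣≤∣x∷p∣ b p)
∣⁅x⁆∪p∣≤1+∣p∣ (Fin.suc x) (inside ∷ p)  = s≤s (∣⁅x⁆∪p∣≤1+∣p∣ x p)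
∣⁅x⁆∪p∣≤1+∣p∣ (Fin.suc x) (outside ∷ p) = ∣⁅x⁆∪p∣≤1+∣p∣ x p

image : ∀ {m n} → (Fin m → Fin n) → Subset n
image {zero}  f = ⊥
image {suc m} f = ⁅ f Fin.zero ⁆ ∪ image (f ∘ Fin.suc)

∣image∣≤ : ∀ {m n} (f : Fin m → Fin n) → ∣ image f ∣ ≤ m
∣image∣≤ {zero} {n} f rewrite ∣⊥∣≡0 n = z≤n
∣image∣≤ {suc m}    f = ≤-trans (∣⁅x⁆∪p∣≤1+∣p∣ (f Fin.zero) _) (s≤s (∣image∣≤ (f ∘ Fin.suc)))

∈image : ∀ {m n} (f : Fin m → Fin n) i → f i ∈ image f
∈image f Fin.zero    = x∈p∪q⁺ (inj₁ (x∈⁅x⁆ (f Fin.zero)))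
∈image f (Fin.suc i) = x∈p∪q⁺ (inj₂ (∈image (f ∘ Fin.suc) i))

injective⇒≤∣p∣ : ∀ {m n} {f : Fin m → Fin n} → Injective _≡_ _≡_ f →
                 ∀ {p} → (∀ i → f i ∈ p) → m ≤ ∣ p ∣
injective⇒≤∣p∣ {zero}          _   _   = z≤n
injective⇒≤∣p∣ {suc m} {f = f} inj f∈p =
  ≤-trans (s≤s (injective⇒≤∣p∣ (suc-injective ∘ inj) f∘suc∈p-f0))
          (x∈p⇒∣p-x∣<∣p∣ (f∈p Fin.zero))
  where
  f∘suc∈p-f0 : ∀ i → f (Fin.suc i) ∈ _ - f Fin.zero
  f∘suc∈p-f0 i = x∈p∧x≢y⇒x∈p-y (f∈p (Fin.suc i)) (0≢1+n ∘ sym ∘ inj)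

module FiniteGraph {N M : ℕ} {V E : Set}
  (vertices : Fin N ↔ V) (edges : Fin M ↔ E) (ends : E → V × V) where

  module Vᶜ = Inverse vertices
  module Eᶜ = Inverse edges

  Incident : E → V → Set
  Incident e v = v ≡ proj₁ (ends e) ⊎ v ≡ proj₂ (ends e)

  Disjoint : E → E → Set
  Disjoint e f = ∀ v → ¬ (Incident e v × Incident f v)

  Loopless : Set
  Loopless = ∀ e → proj₁ (ends e) ≢ proj₂ (ends e)

  Simple : Set
  Simple = ∀ e f → (∀ v → Incident e v → Incident f v) → e ≡ f

  private
    from-injective : ∀ {u v} → Vᶜ.from u ≡ Vᶜ.from v → u ≡ v
    from-injective {u} {v} eq =
      trans (sym (Vᶜ.strictlyInverseˡ u)) (trans (cong Vᶜ.to eq) (Vᶜ.strictlyInverseˡ v))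

    sameEnds⇒incident : ∀ {e f} → SameEnds (map Vᶜ.from Vᶜ.from (ends e)) (map Vᶜ.from Vᶜ.from (ends f)) →
                        ∀ v → Incident e v → Incident f v
    sameEnds⇒incident (inj₁ (p , _)) _ (inj₁ refl) = inj₁ (from-injective p)
    sameEnds⇒incident (inj₁ (_ , q)) _ (inj₂ refl) = inj₂ (from-injective q)
    sameEnds⇒incident (inj₂ (p , _)) _ (inj₁ refl) = inj₂ (from-injective p)
    sameEnds⇒incident (inj₂ (_ , q)) _ (inj₂ refl) = inj₁ (from-injective q)

  graph : V → Loopless → Simple → Graph
  graph v₀ loopless simple = record
    { N        = N
    ; someVtx  = Vᶜ.from v₀
    ; M        = M
    ; ends     = map Vᶜ.from Vᶜ.from ∘ ends ∘ Eᶜ.to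
    ; loopless = λ e → loopless (Eᶜ.to e) ∘ from-injective
    ; simple   = λ e f same → trans (sym (Eᶜ.strictlyInverseʳ e))
                   (trans (cong Eᶜ.from (simple _ _ (sameEnds⇒incident same))) (Eᶜ.strictlyInverseʳ f))
    }

  module Dilation (v₀ : V) (loopless : Loopless) (simple : Simple)
                  (H : Γ₀ (graph v₀ loopless simple)) where
    open Γ₀ H using (nV; blk; blockNonempty)
    open Hypergraph (dilation H) using (edge)

    block : Fin nV → V
    block = Vᶜ.to ∘ blk

    hyperedge⇒incident : ∀ {e x} → edge e x → Incident (Eᶜ.to e) (block x)
    hyperedge⇒incident = Sum.map Vᶜ.inverseˡ Vᶜ.inverseˡ

    incident⇒hyperedge : ∀ {e x} → Incident (Eᶜ.to e) (block x) → edge e x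
    incident⇒hyperedge = Sum.map (λ p → sym (Vᶜ.inverseʳ (sym p))) (λ p → sym (Vᶜ.inverseʳ (sym p)))

    hyperedge-from⇒incident : ∀ {e x} → edge (Eᶜ.from e) x → Incident e (block x)
    hyperedge-from⇒incident {e} {x} =
      subst (λ f → Incident f (block x)) (Eᶜ.strictlyInverseˡ e) ∘ hyperedge⇒incident

    incident⇒hyperedge-from : ∀ {e x} → Incident e (block x) → edge (Eᶜ.from e) x
    incident⇒hyperedge-from {e} {x} =
      incident⇒hyperedge ∘ subst (λ f → Incident f (block x)) (sym (Eᶜ.strictlyInverseˡ e))

    representative : V → Fin nV
    representative v = proj₁ (blockNonempty (Vᶜ.from v))

    block-representative : ∀ v → block (representative v) ≡ v
    block-representative v = Vᶜ.inverseˡ (proj₂ (blockNonempty (Vᶜ.from v)))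

    matching : ∀ {k} (f : Fin k → E) → (∀ i j → i ≢ j → Disjoint (f i) (f j)) →
               Matching (dilation H) k
    matching f disjoint = Eᶜ.from ∘ f , λ i j i≢j x (x∈fi , x∈fj) →
      disjoint i j i≢j (block x) (hyperedge-from⇒incident x∈fi , hyperedge-from⇒incident x∈fj)

    matching≤ : ∀ {n} (index : E → Fin n) →
                (∀ e f → index e ≡ index f → ∃ λ v → Incident e v × Incident f v) →
                ∀ k → Matching (dilation H) k → k ≤ n
    matching≤ index meet k (f , disjoint) = injective⇒≤ index-injective
      where
      index-injective : ∀ {i j} → index (Eᶜ.to (f i)) ≡ index (Eᶜ.to (f j)) → i ≡ j
      index-injective {i} {j} eq with i Fin.≟ j
      ... | yes i≡j = i≡j
      ... | no  i≢j with meet _ _ eq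
      ...   | v , v∈fi , v∈fj = contradiction (onRepresentative v∈fi , onRepresentative v∈fj) (disjoint i j i≢j _)
        where
        onRepresentative : ∀ {e} → Incident (Eᶜ.to e) v → edge e (representative v)
        onRepresentative = incident⇒hyperedge ∘ subst (Incident _) (sym (block-representative v))

    module _ {m} (component : V → Fin m)
             (component-edge : ∀ e {u v} → Incident e u → Incident e v → component u ≡ component v)
             (centre : Fin m → V) (component-centre : ∀ c → component (centre c) ≡ c) where

      domination≥ : ∀ D → Dominating (dilation H) D → m ≤ ∣ D ∣
      domination≥ D dominating = injective⇒≤∣p∣ witness-injective (proj₁ ∘ proj₂ ∘ witness)
        where
        witness : ∀ c → ∃ λ y → y ∈ D × component (block y) ≡ c
        witness c with representative (centre c) ∈? D
        ... | yes r∈D = _ , r∈D , trans (cong component (block-representative _)) (component-centre c)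
        ... | no  r∉D with dominating _ r∉D
        ...   | y , y∈D , e , r∈e , y∈e = y , y∈D ,
                  trans (component-edge _ (hyperedge⇒incident y∈e) (hyperedge⇒incident r∈e))
                        (trans (cong component (block-representative _)) (component-centre c))

        witness-injective : ∀ {i j} → proj₁ (witness i) ≡ proj₁ (witness j) → i ≡ j
        witness-injective {i} {j} eq = trans (sym (proj₂ (proj₂ (witness i))))
                                             (trans (cong (component ∘ block) eq) (proj₂ (proj₂ (witness j))))

      centres : Subset nV
      centres = image (representative ∘ centre)

      centres-dominating : (∀ v → ∃ λ e → Incident e v × Incident e (centre (component v))) →
                           Dominating (dilation H) centres
      centres-dominating near x _ with near (block x)
      ... | e , x∈e , c∈e = representative (centre (component (block x))) , ∈image (representative ∘ centre) _ ,
              Eᶜ.from e , incident⇒hyperedge-from x∈e ,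
              incident⇒hyperedge-from (subst (Incident e) (sym (block-representative _)) c∈e)

      dominationNumber : (∀ v → ∃ λ e → Incident e v × Incident e (centre (component v))) →
                         DominationNumberIs (dilation H) m
      dominationNumber near =
        (centres , centres-dominating near ,
          ≤-antisym (∣image∣≤ _) (domination≥ centres (centres-dominating near))) ,
        domination≥

-- Triangle j consists of the hub of windmill hubOf j and the two tips of j;
-- bladeAt guarantees that every windmill has a triangle.
module Windmills {m n : ℕ} (hubOf : Fin n → Fin (suc m)) (bladeAt : Fin (suc m) → Fin n)
                 (hubOf-bladeAt : ∀ c → hubOf (bladeAt c) ≡ c) where

  Vertex : Set
  Vertex = Fin (suc m) ⊎ (Fin n ⊎ Fin n)

  pattern hub c  = inj₁ c
  pattern tipˡ j = inj₂ (inj₁ j)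
  pattern tipʳ j = inj₂ (inj₂ j)

  Edge : Set
  Edge = Fin n ⊎ (Fin n ⊎ Fin n)

  pattern spokeˡ j = inj₁ j
  pattern spokeʳ j = inj₂ (inj₁ j)
  pattern rim j    = inj₂ (inj₂ j)

  ends : Edge → Vertex × Vertex
  ends (spokeˡ j) = hub (hubOf j) , tipˡ j
  ends (spokeʳ j) = hub (hubOf j) , tipʳ j
  ends (rim j)    = tipˡ j , tipʳ j

  open FiniteGraph (↔-trans +↔⊎ (↔-refl ⊎-↔ +↔⊎)) (↔-trans +↔⊎ (↔-refl ⊎-↔ +↔⊎)) ends

  loopless : Loopless
  loopless (spokeˡ j) ()
  loopless (spokeʳ j) ()
  loopless (rim j)    ()

  simple : Simple
  simple e f e⊆f = sameEnds e f (e⊆f _ (inj₁ refl)) (e⊆f _ (inj₂ refl))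
    where
    sameEnds : ∀ e f → Incident f (proj₁ (ends e)) → Incident f (proj₂ (ends e)) → e ≡ f
    sameEnds (spokeˡ j) (spokeˡ .j) _         (inj₂ refl) = refl
    sameEnds (spokeˡ j) (spokeˡ i)  _         (inj₁ ())
    sameEnds (spokeˡ j) (spokeʳ i)  _         (inj₁ ())
    sameEnds (spokeˡ j) (spokeʳ i)  _         (inj₂ ())
    sameEnds (spokeˡ j) (rim i)     (inj₁ ()) _
    sameEnds (spokeˡ j) (rim i)     (inj₂ ()) _
    sameEnds (spokeʳ j) (spokeˡ i)  _         (inj₁ ())
    sameEnds (spokeʳ j) (spokeˡ i)  _         (inj₂ ())
    sameEnds (spokeʳ j) (spokeʳ .j) _         (inj₂ refl) = refl
    sameEnds (spokeʳ j) (spokeʳ i)  _         (inj₁ ())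
    sameEnds (spokeʳ j) (rim i)     (inj₁ ()) _
    sameEnds (spokeʳ j) (rim i)     (inj₂ ()) _
    sameEnds (rim j)    (spokeˡ i)  _         (inj₁ ())
    sameEnds (rim j)    (spokeˡ i)  _         (inj₂ ())
    sameEnds (rim j)    (spokeʳ i)  (inj₁ ()) _
    sameEnds (rim j)    (spokeʳ i)  (inj₂ ()) _
    sameEnds (rim j)    (rim .j)    (inj₁ refl) _ = refl
    sameEnds (rim j)    (rim i)     (inj₂ ()) _

  windmills : Graph
  windmills = graph (hub Fin.zero) loopless simple

  triangle : Edge → Fin n
  triangle (spokeˡ j) = j
  triangle (spokeʳ j) = j
  triangle (rim j)    = j

  component : Vertex → Fin (suc m)
  component (hub c)  = c
  component (tipˡ j) = hubOf j
  component (tipʳ j) = hubOf j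

  component-incident : ∀ e {v} → Incident e v → component v ≡ hubOf (triangle e)
  component-incident (spokeˡ j) (inj₁ refl) = refl
  component-incident (spokeˡ j) (inj₂ refl) = refl
  component-incident (spokeʳ j) (inj₁ refl) = refl
  component-incident (spokeʳ j) (inj₂ refl) = refl
  component-incident (rim j)    (inj₁ refl) = refl
  component-incident (rim j)    (inj₂ refl) = refl

  component-edge : ∀ e {u v} → Incident e u → Incident e v → component u ≡ component v
  component-edge e u∈e v∈e = trans (component-incident e u∈e) (sym (component-incident e v∈e))

  hub-near : ∀ v → ∃ λ e → Incident e v × Incident e (hub (component v))
  hub-near (hub c)  = spokeˡ (bladeAt c) , hub∈spoke , hub∈spoke
    where
    hub∈spoke : Incident (spokeˡ (bladeAt c)) (hub c)
    hub∈spoke = inj₁ (cong hub (sym (hubOf-bladeAt c)))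
  hub-near (tipˡ j) = spokeˡ j , inj₂ refl , inj₁ refl
  hub-near (tipʳ j) = spokeʳ j , inj₂ refl , inj₁ refl

  rims-disjoint : ∀ i j → i ≢ j → Disjoint (rim i) (rim j)
  rims-disjoint i j i≢j _ (inj₁ refl , inj₁ refl) = i≢j refl
  rims-disjoint i j i≢j _ (inj₁ refl , inj₂ ())
  rims-disjoint i j i≢j _ (inj₂ refl , inj₁ ())
  rims-disjoint i j i≢j _ (inj₂ refl , inj₂ refl) = i≢j refl

  triangle-meets : ∀ e f → triangle e ≡ triangle f → ∃ λ v → Incident e v × Incident f v
  triangle-meets (spokeˡ j) (spokeˡ .j) refl = hub (hubOf j) , inj₁ refl , inj₁ refl
  triangle-meets (spokeˡ j) (spokeʳ .j) refl = hub (hubOf j) , inj₁ refl , inj₁ refl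
  triangle-meets (spokeˡ j) (rim .j)    refl = tipˡ j , inj₂ refl , inj₁ refl
  triangle-meets (spokeʳ j) (spokeˡ .j) refl = hub (hubOf j) , inj₁ refl , inj₁ refl
  triangle-meets (spokeʳ j) (spokeʳ .j) refl = hub (hubOf j) , inj₁ refl , inj₁ refl
  triangle-meets (spokeʳ j) (rim .j)    refl = tipʳ j , inj₂ refl , inj₂ refl
  triangle-meets (rim j)    (spokeˡ .j) refl = tipˡ j , inj₁ refl , inj₂ refl
  triangle-meets (rim j)    (spokeʳ .j) refl = tipʳ j , inj₂ refl , inj₂ refl
  triangle-meets (rim j)    (rim .j)    refl = tipˡ j , inj₁ refl , inj₁ refl

  windmills-numbers : ∀ (H : Γ₀ windmills) →
                      MatchingNumberIs (dilation H) n × DominationNumberIs (dilation H) (suc m)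
  windmills-numbers H =
    (matching rim rims-disjoint , matching≤ triangle triangle-meets) ,
    dominationNumber component component-edge hub (λ _ → refl) hub-near
    where open Dilation (hub Fin.zero) loopless simple H

collapseʳ : ∀ {m} r → Fin (suc m + r) → Fin (suc m)
collapseʳ {m} r t = [ id , const Fin.zero ]′ (splitAt (suc m) t)

collapseʳ-↑ˡ : ∀ {m} r (c : Fin (suc m)) → collapseʳ r (c ↑ˡ r) ≡ c
collapseʳ-↑ˡ {m} r c rewrite splitAt-↑ˡ (suc m) c r = refl

theorem6 : ∀ (n : ℕ) → 2 ≤ n → ∀ (m : ℕ) → 1 ≤ m → m < n →
    Σ Graph λ G → ∀ (H : Γ₀ G) →
    MatchingNumberIs (dilation H) n × DominationNumberIs (dilation H) m
theorem6 n _ zero    () _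
theorem6 n _ (suc m) _  m<n =
  subst (λ n → Σ Graph λ G → ∀ (H : Γ₀ G) →
                 MatchingNumberIs (dilation H) n × DominationNumberIs (dilation H) (suc m))
        (m+[n∸m]≡n (<⇒≤ m<n))
        (windmills , windmills-numbers)
  where open Windmills (collapseʳ (n ∸ suc m)) (_↑ˡ n ∸ suc m) (collapseʳ-↑ˡ (n ∸ suc m))
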